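{- Let $\mathcal{F}$ be a 2-generic $\mathbb{Q}_1$-filter. Then $G_\mathcal{F}$ is infinite.
   Context: A binary string $\sigma$ is identified with the finite set $F_\sigma = \{x < |\sigma| : \sigma(x) = 1\}$; for strings, $\sigma \cup \rho$, $\tau - \sigma$ refer to these finite sets, $\rho \subseteq X$ means $F_\rho \subseteq X$, and $\sigma \preceq \tau$ is the prefix relation; $\Phi_e(\sigma, n, m)$ means the formula evaluated with $G = F_\sigma$. Fix an effective enumeration $\mathcal{U}_0, \mathcal{U}_1, \dots$ of all $\Sigma^0_1$ classes in $2^\omega$ upward closed under $\supseteq$. A largeness class is a class $\mathcal{A} \subseteq 2^\omega$ upward closed under $\supseteq$ such that for every $k$-cover $Y_0 \cup \dots \cup Y_{k-1} \supseteq \omega$ some $Y_j \in \mathcal{A}$. Let $\zeta$ be the computable function with $\mathcal{U}_{\zeta(e,\sigma,n)} = \{X : (\exists \rho \subseteq X - \{0,\dots,|\sigma|\})(\exists m)\neg\Phi_e(\sigma \cup \rho, n, m)\}$ for every index $e$ of a $\Delta_0$ formula $\Phi_e(G,n,m)$, string $\sigma$ and $n$. $\mathbb{Q}_1$ is the set of tuples $(\sigma, X, C, U)$ ($\sigma$ a binary string, $X, C, U \subseteq \omega$) with $X \cap \{0, \dots, |\sigma|\} = \emptyset$, $U \subseteq X$, $\bigcap_{e \in C}\mathcal{U}_e$ a largeness class containing only infinite sets, and $U \in \bigcap_{e \in C}\mathcal{U}_e$; ordered by $(\tau, Y, D, V) \leq (\sigma, X, C, U)$ iff $\sigma \preceq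 \tau$, $Y \subseteq X$, $V \subseteq U$, $C \subseteq D$, $\tau - \sigma \subseteq U$. For $p = (\sigma, X, C, U)$: $p \Vdash (\exists n)(\forall m)\Phi_e(G,n,m)$ iff there is $n$ with $\Phi_e(\sigma \cup \tau, n, m)$ for every string $\tau \subseteq X$ and every $m$; $p \Vdash (\forall n)(\exists m)\neg\Phi_e(G,n,m)$ iff $\zeta(e, \sigma \cup \rho, n) \in C$ for every string $\rho \subseteq U$ and every $n$. A $\mathbb{Q}_1$-filter is a nonempty $\mathcal{F} \subseteq \mathbb{Q}_1$ upward closed under $\leq$ in which any two elements have a common lower bound in $\mathcal{F}$; it is 2-generic if for every $\Delta_0$ formula $\Phi_e(G,n,m)$ some $p \in \mathcal{F}$ satisfies $p \Vdash (\exists n)(\forall m)\Phi_e(G,n,m)$ or $p \Vdash (\forall n)(\exists m)\neg\Phi_e(G,n,m)$. $G_\mathcal{F} = \bigcup\{F_\sigma : (\sigma, X, C, U) \in \mathcal{F}\}$. -}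

module Defs where

open import Data.Nat using (ℕ; zero; suc; _+_; _*_; _<_; _≤_; _≡ᵇ_; _<ᵇ_)
open import Data.Bool using (Bool; true; false; _∧_; _∨_; not)
open import Data.Fin using (Fin) renaming (zero to fzero; suc to fsuc)
open import Data.List using (List; []; _∷_; length; _++_)
open import Data.Product using (Σ; ∃; _×_; _,_)
open import Relation.Binary.PropositionalEquality using (_≡_)
open import Relation.Nullary using (¬_)
import Data.Sum

Set⊆ω : Set
Set⊆ω = ℕ → Bool

_⊆_ : Set⊆ω → Set⊆ω → Set
X ⊆ Y = ∀ x → X x ≡ true → Y x ≡ true

Finite : (ℕ → Set) → Set
Finite P = ∃ λ b → ∀ x → P x → x ≤ b

Infinite : (ℕ → Set) → Set
Infinite P = ¬ Finite P

Str : Set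
Str = List Bool

bit : Str → ℕ → Bool
bit []      _       = false
bit (b ∷ σ) zero    = b
bit (b ∷ σ) (suc x) = bit σ x

F : Str → Set⊆ω
F = bit

_∪s_ : Str → Str → Str
[]      ∪s τ       = τ
σ       ∪s []      = σ
(a ∷ σ) ∪s (b ∷ τ) = (a ∨ b) ∷ (σ ∪s τ)

_⊆ˢ_ : Str → Set⊆ω → Set
ρ ⊆ˢ X = F ρ ⊆ X

_≼_ : Str → Str → Set
σ ≼ τ = ∃ λ rest → τ ≡ σ ++ rest

DiffSub : Str → Str → Set⊆ω → Set
DiffSub τ σ U = ∀ x → bit τ x ≡ true → bit σ x ≡ false → U x ≡ true

-- Δ0 formulas of first-order arithmetic with a set parameter G,
-- in k free number variables (de Bruijn).

data Term (k : ℕ) : Set where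
  var   : Fin k → Term k
  lit   : ℕ → Term k
  plus  : Term k → Term k → Term k
  times : Term k → Term k → Term k

data Fml (k : ℕ) : Set where
  eqF   : Term k → Term k → Fml k
  ltF   : Term k → Term k → Fml k
  memF  : Term k → Fml k
  negF  : Fml k → Fml k
  andF  : Fml k → Fml k → Fml k
  orF   : Fml k → Fml k → Fml k
  ballF : Term k → Fml (suc k) → Fml k
  bexF  : Term k → Fml (suc k) → Fml k

Env : ℕ → Set
Env k = Fin k → ℕ

extend : ∀ {k} → ℕ → Env k → Env (suc k)
extend x ρ fzero    = x
extend x ρ (fsuc i) = ρ i

evalT : ∀ {k} → Env k → Term k → ℕ
evalT ρ (var i)     = ρ i
evalT ρ (lit n)     = n
evalT ρ (plus s t)  = evalT ρ s + evalT ρ t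
evalT ρ (times s t) = evalT ρ s * evalT ρ t

allBelow : ℕ → (ℕ → Bool) → Bool
allBelow zero    f = true
allBelow (suc n) f = allBelow n f ∧ f n

anyBelow : ℕ → (ℕ → Bool) → Bool
anyBelow zero    f = false
anyBelow (suc n) f = anyBelow n f ∨ f n

eval : ∀ {k} → Set⊆ω → Env k → Fml k → Bool
eval G ρ (eqF s t)   = evalT ρ s ≡ᵇ evalT ρ t
eval G ρ (ltF s t)   = evalT ρ s <ᵇ evalT ρ t
eval G ρ (memF t)    = G (evalT ρ t)
eval G ρ (negF φ)    = not (eval G ρ φ)
eval G ρ (andF φ ψ)  = eval G ρ φ ∧ eval G ρ ψ
eval G ρ (orF φ ψ)   = eval G ρ φ ∨ eval G ρ ψ
eval G ρ (ballF t φ) = allBelow (evalT ρ t) (λ x → eval G (extend x ρ) φ)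
eval G ρ (bexF t φ)  = anyBelow (evalT ρ t) (λ x → eval G (extend x ρ) φ)

-- A Δ0 formula Φ(G,n,m): free variable 0 is n, free variable 1 is m.
Δ0 : Set
Δ0 = Fml 2

env2 : ℕ → ℕ → Env 2
env2 n m fzero        = n
env2 n m (fsuc fzero) = m

Φ⟨_⟩ : Δ0 → Str → ℕ → ℕ → Bool
Φ⟨ φ ⟩ σ n m = eval (F σ) (env2 n m) φ

Class : Set₁
Class = Set⊆ω → Set

UpwardClosed : Class → Set
UpwardClosed 𝒜 = ∀ X Y → 𝒜 X → X ⊆ Y → 𝒜 Y

IsCover : (k : ℕ) → (Fin k → Set⊆ω) → Set
IsCover k Y = ∀ x → ∃ λ j → Y j x ≡ true

IsLargeness : Class → Set
IsLargeness 𝒜 = UpwardClosed 𝒜 ×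
  (∀ k (Y : Fin k → Set⊆ω) → IsCover k Y → ∃ λ j → 𝒜 (Y j))

OnlyInfinite : Class → Set
OnlyInfinite 𝒜 = ∀ X → 𝒜 X → Infinite (λ x → X x ≡ true)

-- The enumeration 𝒰 of upward closed Σ⁰₁ classes and the function ζ
-- are taken as parameters.

module Forcing (𝒰 : ℕ → Class) (ζ : Δ0 → Str → ℕ → ℕ) where

  ⋂𝒰 : Set⊆ω → Class
  ⋂𝒰 C X = ∀ e → C e ≡ true → 𝒰 e X

  record Cond : Set where
    constructor ⟨_,_,_,_⟩
    field
      σ : Str
      X : Set⊆ω
      C : Set⊆ω
      U : Set⊆ω

  open Cond public

  InQ₁ : Cond → Set
  InQ₁ p = (∀ x → x ≤ length (σ p) → X p x ≡ false)
         × (U p ⊆ X p)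
         × IsLargeness (⋂𝒰 (C p))
         × OnlyInfinite (⋂𝒰 (C p))
         × ⋂𝒰 (C p) (U p)

  _≤Q_ : Cond → Cond → Set
  q ≤Q p = (σ p ≼ σ q) × (X q ⊆ X p) × (U q ⊆ U p) × (C p ⊆ C q)
         × DiffSub (σ q) (σ p) (U p)

  -- p ⊩ (∃ n)(∀ m) Φ(G,n,m)
  ForcesΣ₂ : Cond → Δ0 → Set
  ForcesΣ₂ p φ = ∃ λ n → ∀ τ → τ ⊆ˢ X p → ∀ m →
                   Φ⟨ φ ⟩ (σ p ∪s τ) n m ≡ true

  -- p ⊩ (∀ n)(∃ m) ¬Φ(G,n,m)
  ForcesΠ₂ : Cond → Δ0 → Set
  ForcesΠ₂ p φ = ∀ ρ → ρ ⊆ˢ U p → ∀ n → C p (ζ φ (σ p ∪s ρ) n) ≡ true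

  IsFilter : (Cond → Set) → Set
  IsFilter 𝓕 = (∀ p → 𝓕 p → InQ₁ p)
             × (∃ λ p → 𝓕 p)
             × (∀ p q → 𝓕 p → InQ₁ q → p ≤Q q → 𝓕 q)
             × (∀ p q → 𝓕 p → 𝓕 q → ∃ λ r → 𝓕 r × r ≤Q p × r ≤Q q)

  Is2Generic : (Cond → Set) → Set
  Is2Generic 𝓕 = ∀ (φ : Δ0) → ∃ λ p → 𝓕 p × (ForcesΣ₂ p φ Data.Sum.⊎ ForcesΠ₂ p φ)

  G_ : (Cond → Set) → ℕ → Set
  G_ 𝓕 x = ∃ λ p → 𝓕 p × F (σ p) x ≡ true

ZetaSpec : (ℕ → Class) → (Δ0 → Str → ℕ → ℕ) → Set
ZetaSpec 𝒰 ζ = ∀ φ σ n X →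
  (𝒰 (ζ φ σ n) X →
     ∃ λ ρ → ρ ⊆ˢ X × (∀ x → F ρ x ≡ true → length σ < x)
             × ∃ λ m → Φ⟨ φ ⟩ (σ ∪s ρ) n m ≡ false)
  × ((∃ λ ρ → ρ ⊆ˢ X × (∀ x → F ρ x ≡ true → length σ < x)
             × ∃ λ m → Φ⟨ φ ⟩ (σ ∪s ρ) n m ≡ false) →
     𝒰 (ζ φ σ n) X)

module Submission where

open import Defs
open import Data.Nat using (ℕ; zero; suc; _+_; _<_; _≤_; _<ᵇ_; s≤s)
open import Data.Nat.Properties
  using (<ᵇ⇒<; <⇒<ᵇ; ≮⇒≥; <⇒≱; ≤-<-trans; m≤m+n; m≤n+m; m≤n⇒m<n∨m≡n; n<1+n; m<n⇒m<1+n; <⇒≤)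
open import Data.Bool using (Bool; true; false; _∧_; _∨_)
open import Data.Bool.Properties using (∨-zeroʳ; ∨-identityʳ; ∧-zeroʳ; T-≡)
open import Data.Fin using () renaming (zero to fzero; suc to fsuc)
open import Data.List using ([]; _∷_)
open import Data.Product using (∃; _×_; _,_; proj₁)
open import Data.Sum using (inj₁; inj₂; [_,_])
open import Data.Empty using (⊥; ⊥-elim)
open import Function.Bundles using (Equivalence)
open import Relation.Binary.PropositionalEquality using (_≡_; refl; sym; trans; cong)
open import Relation.Nullary using (¬_)

-- Suppose G_𝓕 ⊆ {0,…,b} and let Φ_b(G,n,m) say "if G meets (b,m) then G meets
-- (b,n)". Some p ∈ 𝓕 forces (∃n)(∀m)Φ_b or (∀n)(∃m)¬Φ_b, and its reservoir U is
-- infinite. In the first case σ ∪ {x}, for x ∈ U above b and n, meets (b, x+1)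
-- but not (b,n). In the second case, for x ∈ U above b, the class coded by
-- ζ(σ ∪ {x}, x+1) contains U, so some extension of σ ∪ {x} misses (b, x+1),
-- which is impossible since it contains x.

<ᵇ-true : ∀ {m n} → m < n → (m <ᵇ n) ≡ true
<ᵇ-true m<n = Equivalence.to T-≡ (<⇒<ᵇ m<n)

<ᵇ-true⇒< : ∀ {m n} → (m <ᵇ n) ≡ true → m < n
<ᵇ-true⇒< {m} {n} e = <ᵇ⇒< m n (Equivalence.from T-≡ e)

infinite⇒¬¬above : ∀ {P : ℕ → Set} c → Infinite P → ¬ ¬ ∃ λ x → P x × c < x
infinite⇒¬¬above c infinite noneAbove =
  infinite (c , λ x px → ≮⇒≥ (λ c<x → noneAbove (x , px , c<x)))

anyBelow-true : ∀ n (f : ℕ → Bool) x → f x ≡ true → x < n → anyBelow n f ≡ true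
anyBelow-true (suc n) f x fx (s≤s x≤n) with m≤n⇒m<n∨m≡n x≤n
... | inj₁ x<n rewrite anyBelow-true n f x fx x<n = refl
... | inj₂ refl rewrite fx = ∨-zeroʳ _

anyBelow-false : ∀ n (f : ℕ → Bool) → (∀ y → y < n → f y ≡ false) → anyBelow n f ≡ false
anyBelow-false zero    f _ = refl
anyBelow-false (suc n) f allFalse
  rewrite anyBelow-false n f (λ y y<n → allFalse y (m<n⇒m<1+n y<n)) | allFalse n (n<1+n n) = refl

bit-∪s : ∀ σ τ x → bit (σ ∪s τ) x ≡ (bit σ x ∨ bit τ x)
bit-∪s []      τ       x       = refl
bit-∪s (a ∷ σ) []      x       = sym (∨-identityʳ _)
bit-∪s (a ∷ σ) (b ∷ τ) zero    = refl
bit-∪s (a ∷ σ) (b ∷ τ) (suc x) = bit-∪s σ τ x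

bit-∪s-introʳ : ∀ σ τ x → bit τ x ≡ true → bit (σ ∪s τ) x ≡ true
bit-∪s-introʳ σ τ x τx rewrite bit-∪s σ τ x | τx = ∨-zeroʳ _

bit-∪s-introˡ : ∀ σ τ x → bit σ x ≡ true → bit (σ ∪s τ) x ≡ true
bit-∪s-introˡ σ τ x σx rewrite bit-∪s σ τ x | σx = refl

⁅_⁆ : ℕ → Str
⁅ zero  ⁆ = true ∷ []
⁅ suc x ⁆ = false ∷ ⁅ x ⁆

bit-⁅x⁆-x : ∀ x → bit ⁅ x ⁆ x ≡ true
bit-⁅x⁆-x zero    = refl
bit-⁅x⁆-x (suc x) = bit-⁅x⁆-x x

bit-⁅x⁆⇒≡ : ∀ x y → bit ⁅ x ⁆ y ≡ true → y ≡ x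
bit-⁅x⁆⇒≡ zero    zero    _ = refl
bit-⁅x⁆⇒≡ (suc x) (suc y) e = cong suc (bit-⁅x⁆⇒≡ x y e)

⁅⁆⊆ˢ : ∀ {x} {X : Set⊆ω} → X x ≡ true → ⁅ x ⁆ ⊆ˢ X
⁅⁆⊆ˢ {x} Xx y e rewrite bit-⁅x⁆⇒≡ x y e = Xx

bit-∪s⁅⁆-above : ∀ σ {b} x → (∀ y → bit σ y ≡ true → y ≤ b)
               → ∀ y → bit (σ ∪s ⁅ x ⁆) y ≡ true → b < y → y ≡ x
bit-∪s⁅⁆-above σ x σ≤b y e b<y rewrite bit-∪s σ ⁅ x ⁆ y with bit σ y in σy
... | true  = ⊥-elim (<⇒≱ b<y (σ≤b y σy))
... | false = bit-⁅x⁆⇒≡ x y e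

meetsAbove : ∀ {k} → ℕ → Term k → Fml k
meetsAbove b t = bexF t (andF (ltF (lit b) (var fzero)) (memF (var fzero)))

meetsAbove-true : ∀ {k} G (ρ : Env k) b t x
                → G x ≡ true → b < x → x < evalT ρ t → eval G ρ (meetsAbove b t) ≡ true
meetsAbove-true G ρ b t x Gx b<x x<t =
  anyBelow-true (evalT ρ t) _ x trueAt x<t
  where
  trueAt : ((b <ᵇ x) ∧ G x) ≡ true
  trueAt rewrite <ᵇ-true b<x = Gx

meetsAbove-false : ∀ {k} G (ρ : Env k) b t
                 → (∀ y → G y ≡ true → b < y → evalT ρ t ≤ y) → eval G ρ (meetsAbove b t) ≡ false
meetsAbove-false G ρ b t aboveBeyond = anyBelow-false (evalT ρ t) _ falseAt
  where
  falseAt : ∀ y → y < evalT ρ t → ((b <ᵇ y) ∧ G y) ≡ false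
  falseAt y y<t with G y in Gy | b <ᵇ y in b<ᵇy
  ... | false | _     = ∧-zeroʳ _
  ... | true  | false = refl
  ... | true  | true  = ⊥-elim (<⇒≱ y<t (aboveBeyond y Gy (<ᵇ-true⇒< b<ᵇy)))

gap : ℕ → Δ0
gap b = orF (negF (meetsAbove b (var (fsuc fzero)))) (meetsAbove b (var fzero))

module _ (𝒰 : ℕ → Class) (ζ : Δ0 → Str → ℕ → ℕ) where
  open Forcing 𝒰 ζ

  ¬ForcesΣ₂-gap : ∀ p b → (∀ y → bit (σ p) y ≡ true → y ≤ b) → U p ⊆ X p
                → Infinite (λ x → U p x ≡ true) → ¬ ForcesΣ₂ p (gap b)
  ¬ForcesΣ₂-gap p b σ≤b U⊆X U-infinite (n , forced) =
    infinite⇒¬¬above (b + n) U-infinite λ (x , Ux , b+n<x) → refute x Ux b+n<x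
    where
    refute : ∀ x → U p x ≡ true → b + n < x → ⊥
    refute x Ux b+n<x with trans (sym (forced ⁅ x ⁆ (⁅⁆⊆ˢ (U⊆X x Ux)) (suc x))) Φ-false
      where
      s = σ p ∪s ⁅ x ⁆
      b<x : b < x
      b<x = ≤-<-trans (m≤m+n b n) b+n<x
      onlyxAbove : ∀ y → bit s y ≡ true → b < y → n ≤ y
      onlyxAbove y sy b<y rewrite bit-∪s⁅⁆-above (σ p) x σ≤b y sy b<y = <⇒≤ (≤-<-trans (m≤n+m n b) b+n<x)
      Φ-false : Φ⟨ gap b ⟩ s n (suc x) ≡ false
      Φ-false
        rewrite meetsAbove-true (bit s) (env2 n (suc x)) b (var (fsuc fzero)) x
                  (bit-∪s-introʳ (σ p) ⁅ x ⁆ x (bit-⁅x⁆-x x)) b<x (n<1+n x)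
              | meetsAbove-false (bit s) (env2 n (suc x)) b (var fzero) onlyxAbove = refl
    ... | ()

  ¬ForcesΠ₂-gap : ZetaSpec 𝒰 ζ → ∀ p b → ⋂𝒰 (C p) (U p)
                → Infinite (λ x → U p x ≡ true) → ¬ ForcesΠ₂ p (gap b)
  ¬ForcesΠ₂-gap spec p b U∈⋂𝒰 U-infinite forced =
    infinite⇒¬¬above b U-infinite λ (x , Ux , b<x) → refute x Ux b<x
    where
    refute : ∀ x → U p x ≡ true → b < x → ⊥
    refute x Ux b<x
      with proj₁ (spec (gap b) (σ p ∪s ⁅ x ⁆) (suc x) (U p)) (U∈⋂𝒰 _ (forced ⁅ x ⁆ (⁅⁆⊆ˢ Ux) (suc x)))
    ... | ρ , _ , _ , m , Φ≡false with trans (sym Φ≡false) Φ-true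
      where
      s = (σ p ∪s ⁅ x ⁆) ∪s ρ
      Φ-true : Φ⟨ gap b ⟩ s (suc x) m ≡ true
      Φ-true
        rewrite meetsAbove-true (bit s) (env2 (suc x) m) b (var fzero) x
                  (bit-∪s-introˡ (σ p ∪s ⁅ x ⁆) ρ x (bit-∪s-introʳ (σ p) ⁅ x ⁆ x (bit-⁅x⁆-x x))) b<x (n<1+n x)
        = ∨-zeroʳ _
    ... | ()

lemma2p30 : (𝒰 : ℕ → Class) (ζ : Δ0 → Str → ℕ → ℕ)
    → (∀ e → UpwardClosed (𝒰 e))
    → ZetaSpec 𝒰 ζ
    → (𝓕 : Forcing.Cond 𝒰 ζ → Set)
    → Forcing.IsFilter 𝒰 ζ 𝓕
    → Forcing.Is2Generic 𝒰 ζ 𝓕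
    → Infinite (Forcing.G_ 𝒰 ζ 𝓕)
lemma2p30 𝒰 ζ _ spec 𝓕 (inQ₁ , _) generic (b , G≤b) with generic (gap b)
... | p , p∈𝓕 , forces with inQ₁ p p∈𝓕
...   | _ , U⊆X , _ , onlyInfinite , U∈⋂𝒰 =
  [ ¬ForcesΣ₂-gap 𝒰 ζ p b σ≤b U⊆X (onlyInfinite (U p) U∈⋂𝒰)
  , ¬ForcesΠ₂-gap 𝒰 ζ spec p b U∈⋂𝒰 (onlyInfinite (U p) U∈⋂𝒰)
  ] forces
  where
  open Forcing 𝒰 ζ using (σ; U)
  σ≤b : ∀ y → bit (σ p) y ≡ true → y ≤ b
  σ≤b y σy = G≤b y (p , p∈𝓕 , σy)
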